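{- In the theory CaTT: (1) weakening holds (if $\Gamma\vdash A$ and $\Gamma::(y,B)\vdash$ then $\Gamma::(y,B)\vdash A$, and similarly for terms and substitutions) and derivability is preserved by the inference rules (sub-derivations of derivable judgements are derivable; derivable substitutions send derivable types and terms to derivable ones); (2) CaTT has the structure of a category with families: the identity substitution $\mathrm{id}_\Gamma$ is derivable and acts trivially, composition of derivable substitutions is derivable, associative and unital, and $A[\gamma][\delta]=A[\gamma\circ\delta]$, $t[\gamma][\delta]=t[\gamma\circ\delta]$ for derivable $A$ (resp. $t$), $\gamma$, $\delta$; (3) every derivable judgement has a unique derivation tree; (4) the sphere contexts classify types: for every raw context $\Gamma$ the map $\Sigma_n\mathrm{Sub}(\Gamma,\mathbb{S}^n)\to\mathrm{Ty}(\Gamma)$, $(n,\gamma)\mapsto U_n[\gamma]$, is an equivalence; (5) type checking is decidable for all four judgements.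
   Context: Meta-theory: Martin-Löf type theory without axiom K. Glob raw syntax and ps-judgements: raw types $*$, $\Rightarrow(A,t,u)$, raw terms $\mathrm{Var}\,x$ ($x\in\mathbb{N}$), raw contexts finite lists of pairs $(x,A)$ ($\mathrm{nil}$ empty, $L::p$ appends $p$, $\ell(L)$ length, $\mathrm{drop}(L)$ removes the last appended element). (pss) $\mathrm{nil}::(0,*)\vdash_{ps}0:*$; (psd) from $\Gamma\vdash_{ps}f:\Rightarrow(A,\mathrm{Var}\,x,\mathrm{Var}\,y)$ derive $\Gamma\vdash_{ps}y:A$; (pse) from $\Gamma\vdash_{ps}x:A$, $l=\ell(\Gamma)$, derive $(\Gamma::(l,A))::(l+1,\Rightarrow(A,\mathrm{Var}\,x,\mathrm{Var}\,l))\vdash_{ps}l+1:\Rightarrow(A,\mathrm{Var}\,x,\mathrm{Var}\,l)$; (ps) from $\Gamma\vdash_{ps}x:*$ derive $\Gamma\vdash_{ps}$. $\dim(*)=0$, $\dim(\Rightarrow(A,t,u))=\dim A+1$, $\dim_C(\Gamma)$ = max of $\dim A$ over $(x,A)\in\Gamma$. For $d:\Gamma\vdash_{ps}x:A$ and $i\in\mathbb{N}$: (pss) $\mathrm{src}_i=\mathrm{tgt}_i=\mathrm{nil}$ if $i=0$, else $[0]$; (psd) from $d'$: same as $d'$; (pse) from $d':\Gamma\vdash_{ps}x:A$, $l=\ell(\Gamma)$: if $i\le\dim A+1$, $\mathrm{src}_i(d)=\mathrm{src}_i(d')$ and $\mathrm{tgt}_i(d)=\mathrm{drop}(\mathrm{tgt}_i(d'))::l$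 when $i=\dim A+1$, else $\mathrm{tgt}_i(d')$; if $i>\dim A+1$, both get $::l::(l+1)$ appended to those of $d'$. For $(\Gamma,\mathrm{ps}(d))$, $\mathrm{src}(\Gamma)$, $\mathrm{tgt}(\Gamma)$ are the sets of elements of $\mathrm{src}_{\dim_C\Gamma}(d)$, $\mathrm{tgt}_{\dim_C\Gamma}(d)$. CaTT raw syntax, defined mutually with index type $J$: raw types $*$, $\Rightarrow(A,t,u)$; raw terms $\mathrm{Var}\,x$ and $c_j(\gamma)$ ($j\in J$, $\gamma$ raw substitution = finite list of pairs $(x,t)$); raw contexts finite lists of pairs $(x,A)$. $V(*)=\emptyset$, $V(\Rightarrow(A,t,u))=V(A)\cup V(t)\cup V(u)$, $V(\mathrm{Var}\,x)=\{x\}$, $V(c_j(\gamma))$ = union of $V(t)$, $(x,t)\in\gamma$; $V(\Gamma)$ = first components of $\Gamma$. "$A$ full in $\Gamma$": either (Cop) $A=\Rightarrow(B,t,u)$ with $\mathrm{src}(\Gamma)=V(B)\cup V(t)$, $\mathrm{tgt}(\Gamma)=V(B)\cup V(u)$, or (Ccoh) $V(\Gamma)=V(A)$. $J$ = tuples $(\Gamma,d,A,w)$: $\Gamma$ raw Glob context, $d:\Gamma\vdash_{ps}$, $A$ raw CaTT type, $w$ a fullness witness; $C_j=\Gamma$, $T_j=A$. Substitution: $*[\gamma]=*$; $\Rightarrow(A,t,u)[\gamma]=\Rightarrow(A[\gamma],t[\gamma],u[\gamma])$; $\mathrm{Var}\,x[\mathrm{nil}]=\mathrm{Var}\,x$;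 $\mathrm{Var}\,x[\gamma::(v,t)]=t$ if $x=v$, else $\mathrm{Var}\,x[\gamma]$; $c_j(\gamma)[\delta]=c_j(\gamma\circ\delta)$; $\mathrm{nil}\circ\delta=\mathrm{nil}$, $(\gamma::(x,t))\circ\delta=(\gamma\circ\delta)::(x,t[\delta])$; $\mathrm{id}_{\mathrm{nil}}=\mathrm{nil}$, $\mathrm{id}_{\Gamma::(x,A)}=\mathrm{id}_\Gamma::(x,\mathrm{Var}\,x)$. CaTT judgements (mutually inductive): (ec) $\mathrm{nil}\vdash$; (cc) from $\Gamma\vdash$, $\Gamma\vdash A$, $x=\ell(\Gamma)$ derive $\Gamma::(x,A)\vdash$; (ob) from $\Gamma\vdash$ derive $\Gamma\vdash*$; (ar) from $\Gamma\vdash t:A$, $\Gamma\vdash u:A$ derive $\Gamma\vdash\Rightarrow(A,t,u)$; (var) from $\Gamma\vdash$, $(x,A)\in\Gamma$ derive $\Gamma\vdash\mathrm{Var}\,x:A$; (tm) from $C_j\vdash T_j$ and $\Delta\vdash\gamma:C_j$ derive $\Delta\vdash c_j(\gamma):T_j[\gamma]$; (es) from $\Delta\vdash$ derive $\Delta\vdash\mathrm{nil}:\mathrm{nil}$; (sc) from $\Delta\vdash\gamma:\Gamma$, $\Gamma::(x,A)\vdash$, $\Delta\vdash t:A[\gamma]$, $x=y$ derive $\Delta\vdash\gamma::(y,t):\Gamma::(x,A)$. $\mathrm{Ty}(\Gamma)=\Sigma_A(\Gamma\vdash A)$, $\mathrm{Sub}(\Delta,\Gamma)=\Sigma_\gamma(\Delta\vdash\gamma:\Gamma)$;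 $U_0=*$, $U_{n+1}=\Rightarrow(U_n,\mathrm{Var}\,2n,\mathrm{Var}\,(2n+1))$, $\mathbb{S}^0=\mathrm{nil}$, $\mathbb{S}^{n+1}=\mathbb{D}^n::(\ell(\mathbb{D}^n),U_n)$, $\mathbb{D}^n=\mathbb{S}^n::(\ell(\mathbb{S}^n),U_n)$. Decidable means an element of $X+\neg X$ can be constructed; unique derivation means the judgement type is a proposition. -}

{-# OPTIONS --without-K #-}
module Defs where

open import Data.Nat using (ℕ; zero; suc; _+_; _*_; _⊔_; _≡ᵇ_; _≤ᵇ_)
open import Data.Bool using (Bool; true; false; if_then_else_; T; _∨_)
open import Data.Product using (Σ; Σ-syntax; _×_; _,_; proj₁)
open import Data.Sum using (_⊎_)
open import Data.Unit using (⊤)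
open import Relation.Binary.PropositionalEquality using (_≡_)
open import Relation.Nullary using (Dec)
open import Function.Bundles using (_↔_; Inverse)

infixl 5 _::_
data SList (X : Set) : Set where
  nil  : SList X
  _::_ : SList X → X → SList X

len : {X : Set} → SList X → ℕ
len nil      = 0
len (L :: _) = suc (len L)

drop : {X : Set} → SList X → SList X
drop nil      = nil
drop (L :: _) = L

_++_ : {X : Set} → SList X → SList X → SList X
L ++ nil      = L
L ++ (M :: x) = (L ++ M) :: x

data _∈_ {X : Set} (a : X) : SList X → Set where
  here  : {L : SList X} → a ∈ (L :: a)
  there : {L : SList X} {b : X} → a ∈ L → a ∈ (L :: b)

-- finite sets of variables are represented by lists of naturals;
-- boolean membership, inclusion and equality *as sets*
_∈ᵇ_ : ℕ → SList ℕ → Bool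
x ∈ᵇ nil      = false
x ∈ᵇ (L :: y) = (x ≡ᵇ y) ∨ (x ∈ᵇ L)

_⊆_ : SList ℕ → SList ℕ → Set
nil ⊆ M      = ⊤
(L :: x) ⊆ M = (L ⊆ M) × T (x ∈ᵇ M)

_≐_ : SList ℕ → SList ℕ → Set
L ≐ M = (L ⊆ M) × (M ⊆ L)

data GTm : Set where
  gVar : ℕ → GTm

data GTy : Set where
  g⋆ : GTy
  g⇒ : GTy → GTm → GTm → GTy

GCtx : Set
GCtx = SList (ℕ × GTy)

gdim : GTy → ℕ
gdim g⋆          = 0
gdim (g⇒ A _ _)  = suc (gdim A)

gdimC : GCtx → ℕ
gdimC nil            = 0
gdimC (Γ :: (_ , A)) = gdimC Γ ⊔ gdim A

gvarsC : GCtx → SList ℕ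
gvarsC nil            = nil
gvarsC (Γ :: (x , _)) = gvarsC Γ :: x

data _⊢ps_∶_ : GCtx → ℕ → GTy → Set where
  pss : (nil :: (0 , g⋆)) ⊢ps 0 ∶ g⋆
  psd : {Γ : GCtx} {f x y : ℕ} {A : GTy} →
        Γ ⊢ps f ∶ g⇒ A (gVar x) (gVar y) → Γ ⊢ps y ∶ A
  pse : {Γ : GCtx} {x : ℕ} {A : GTy} {l : ℕ} →
        Γ ⊢ps x ∶ A → l ≡ len Γ →
        ((Γ :: (l , A)) :: (suc l , g⇒ A (gVar x) (gVar l)))
          ⊢ps suc l ∶ g⇒ A (gVar x) (gVar l)

data _⊢ps (Γ : GCtx) : Set where
  ps : {x : ℕ} → Γ ⊢ps x ∶ g⋆ → Γ ⊢ps

srcᵢ : {Γ : GCtx} {x : ℕ} {A : GTy} → ℕ → Γ ⊢ps x ∶ A → SList ℕ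
srcᵢ zero    pss = nil
srcᵢ (suc _) pss = nil :: 0
srcᵢ i (psd d) = srcᵢ i d
srcᵢ i (pse {A = A} {l = l} d _) =
  if i ≤ᵇ suc (gdim A) then srcᵢ i d else ((srcᵢ i d :: l) :: suc l)

tgtᵢ : {Γ : GCtx} {x : ℕ} {A : GTy} → ℕ → Γ ⊢ps x ∶ A → SList ℕ
tgtᵢ zero    pss = nil
tgtᵢ (suc _) pss = nil :: 0
tgtᵢ i (psd d) = tgtᵢ i d
tgtᵢ i (pse {A = A} {l = l} d _) =
  if i ≤ᵇ suc (gdim A)
  then (if i ≡ᵇ suc (gdim A) then (drop (tgtᵢ i d) :: l) else tgtᵢ i d)
  else ((tgtᵢ i d :: l) :: suc l)

-- src(Γ), tgt(Γ) for a ps-context (Γ, ps(d)), as lists whose set of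
-- elements is the intended set
srcC : {Γ : GCtx} → Γ ⊢ps → SList ℕ
srcC {Γ} (ps d) = srcᵢ (gdimC Γ) d

tgtC : {Γ : GCtx} → Γ ⊢ps → SList ℕ
tgtC {Γ} (ps d) = tgtᵢ (gdimC Γ) d

-- CaTT raw syntax, mutually with the index type J
-- (induction-recursion: fullness refers to the variable function V)

mutual
  data Ty : Set where
    ⋆ : Ty
    ⇒ : Ty → Tm → Tm → Ty

  data Tm : Set where
    Var : ℕ → Tm
    c   : J → SList (ℕ × Tm) → Tm

  data J : Set where
    mkJ : (Γ : GCtx) (d : Γ ⊢ps) (A : Ty) → Full Γ d A → J

  varsTy : Ty → SList ℕ
  varsTy ⋆          = nil
  varsTy (⇒ A t u)  = (varsTy A ++ varsTm t) ++ varsTm u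

  varsTm : Tm → SList ℕ
  varsTm (Var x) = nil :: x
  varsTm (c _ γ) = varsSub γ

  varsSub : SList (ℕ × Tm) → SList ℕ
  varsSub nil            = nil
  varsSub (γ :: (_ , t)) = varsSub γ ++ varsTm t

  Full : (Γ : GCtx) → Γ ⊢ps → Ty → Set
  Full Γ d ⋆ = gvarsC Γ ≐ varsTy ⋆
  Full Γ d (⇒ B t u) =
    ((srcC d ≐ (varsTy B ++ varsTm t)) × (tgtC d ≐ (varsTy B ++ varsTm u)))
    ⊎ (gvarsC Γ ≐ varsTy (⇒ B t u))

Sub : Set
Sub = SList (ℕ × Tm)

Ctx : Set
Ctx = SList (ℕ × Ty)

embTy : GTy → Ty
embTy g⋆                         = ⋆
embTy (g⇒ A (gVar x) (gVar y))   = ⇒ (embTy A) (Var x) (Var y)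

embC : GCtx → Ctx
embC nil            = nil
embC (Γ :: (x , A)) = embC Γ :: (x , embTy A)

C : J → Ctx
C (mkJ Γ _ _ _) = embC Γ

Tj : J → Ty
Tj (mkJ _ _ A _) = A

mutual
  _[_]T : Ty → Sub → Ty
  ⋆ [ γ ]T         = ⋆
  ⇒ A t u [ γ ]T   = ⇒ (A [ γ ]T) (t [ γ ]t) (u [ γ ]t)

  _[_]t : Tm → Sub → Tm
  Var x [ nil ]t           = Var x
  Var x [ γ :: (v , t) ]t  = if x ≡ᵇ v then t else (Var x [ γ ]t)
  c j γ [ δ ]t             = c j (γ ∘ δ)

  _∘_ : Sub → Sub → Sub
  nil ∘ δ            = nil
  (γ :: (x , t)) ∘ δ = (γ ∘ δ) :: (x , t [ δ ]t)

id : Ctx → Sub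
id nil            = nil
id (Γ :: (x , A)) = id Γ :: (x , Var x)

infix 4 _⊢C _⊢T_ _⊢t_∶_ _⊢s_∶_

mutual
  data _⊢C : Ctx → Set where
    ec : nil ⊢C
    cc : {Γ : Ctx} {A : Ty} {x : ℕ} →
         Γ ⊢C → Γ ⊢T A → x ≡ len Γ → (Γ :: (x , A)) ⊢C

  data _⊢T_ : Ctx → Ty → Set where
    ob : {Γ : Ctx} → Γ ⊢C → Γ ⊢T ⋆
    ar : {Γ : Ctx} {A : Ty} {t u : Tm} →
         Γ ⊢t t ∶ A → Γ ⊢t u ∶ A → Γ ⊢T ⇒ A t u

  data _⊢t_∶_ : Ctx → Tm → Ty → Set where
    var : {Γ : Ctx} {x : ℕ} {A : Ty} →
          Γ ⊢C → (x , A) ∈ Γ → Γ ⊢t Var x ∶ A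
    tm  : {Δ : Ctx} {j : J} {γ : Sub} →
          C j ⊢T Tj j → Δ ⊢s γ ∶ C j → Δ ⊢t c j γ ∶ (Tj j [ γ ]T)

  data _⊢s_∶_ : Ctx → Sub → Ctx → Set where
    es : {Δ : Ctx} → Δ ⊢C → Δ ⊢s nil ∶ nil
    sc : {Δ Γ : Ctx} {γ : Sub} {x y : ℕ} {A : Ty} {t : Tm} →
         Δ ⊢s γ ∶ Γ → (Γ :: (x , A)) ⊢C → Δ ⊢t t ∶ (A [ γ ]T) → x ≡ y →
         Δ ⊢s (γ :: (y , t)) ∶ (Γ :: (x , A))

TyD : Ctx → Set
TyD Γ = Σ[ A ∈ Ty ] (Γ ⊢T A)

SubD : Ctx → Ctx → Set
SubD Δ Γ = Σ[ γ ∈ Sub ] (Δ ⊢s γ ∶ Γ)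

U : ℕ → Ty
U zero    = ⋆
U (suc n) = ⇒ (U n) (Var (2 * n)) (Var (suc (2 * n)))

mutual
  𝕊 : ℕ → Ctx
  𝕊 zero    = nil
  𝕊 (suc n) = 𝔻 n :: (len (𝔻 n) , U n)

  𝔻 : ℕ → Ctx
  𝔻 n = 𝕊 n :: (len (𝕊 n) , U n)

Weakening : Set
Weakening =
  ({Γ : Ctx} {y : ℕ} {A B : Ty} → Γ ⊢T A → (Γ :: (y , B)) ⊢C → (Γ :: (y , B)) ⊢T A)
  × ({Γ : Ctx} {y : ℕ} {B : Ty} {t : Tm} {A : Ty} →
       Γ ⊢t t ∶ A → (Γ :: (y , B)) ⊢C → (Γ :: (y , B)) ⊢t t ∶ A)
  × ({Δ Γ : Ctx} {y : ℕ} {B : Ty} {γ : Sub} →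
       Δ ⊢s γ ∶ Γ → (Δ :: (y , B)) ⊢C → (Δ :: (y , B)) ⊢s γ ∶ Γ)

Preservation : Set
Preservation =
  ({Γ : Ctx} {x : ℕ} {A : Ty} → (Γ :: (x , A)) ⊢C → Γ ⊢C × Γ ⊢T A)
  × ({Γ : Ctx} {A : Ty} → Γ ⊢T A → Γ ⊢C)
  × ({Γ : Ctx} {t : Tm} {A : Ty} → Γ ⊢t t ∶ A → Γ ⊢T A)
  × ({Δ Γ : Ctx} {γ : Sub} → Δ ⊢s γ ∶ Γ → Δ ⊢C × Γ ⊢C)
  × ({Δ Γ : Ctx} {γ : Sub} {A : Ty} → Δ ⊢s γ ∶ Γ → Γ ⊢T A → Δ ⊢T (A [ γ ]T))
  × ({Δ Γ : Ctx} {γ : Sub} {t : Tm} {A : Ty} →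
       Δ ⊢s γ ∶ Γ → Γ ⊢t t ∶ A → Δ ⊢t (t [ γ ]t) ∶ (A [ γ ]T))

CwF : Set
CwF =
  ({Γ : Ctx} → Γ ⊢C → Γ ⊢s id Γ ∶ Γ)
  × ({Γ : Ctx} {A : Ty} → Γ ⊢T A → A [ id Γ ]T ≡ A)
  × ({Γ : Ctx} {t : Tm} {A : Ty} → Γ ⊢t t ∶ A → t [ id Γ ]t ≡ t)
  × ({Θ Δ Γ : Ctx} {γ δ : Sub} → Δ ⊢s γ ∶ Γ → Θ ⊢s δ ∶ Δ → Θ ⊢s (γ ∘ δ) ∶ Γ)
  × ({Ξ Θ Δ Γ : Ctx} {γ δ θ : Sub} →
       Δ ⊢s γ ∶ Γ → Θ ⊢s δ ∶ Δ → Ξ ⊢s θ ∶ Θ → (γ ∘ δ) ∘ θ ≡ γ ∘ (δ ∘ θ))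
  × ({Δ Γ : Ctx} {γ : Sub} → Δ ⊢s γ ∶ Γ → (id Γ ∘ γ) ≡ γ × (γ ∘ id Δ) ≡ γ)
  × ({Θ Δ Γ : Ctx} {γ δ : Sub} {A : Ty} →
       Γ ⊢T A → Δ ⊢s γ ∶ Γ → Θ ⊢s δ ∶ Δ → (A [ γ ]T) [ δ ]T ≡ A [ γ ∘ δ ]T)
  × ({Θ Δ Γ : Ctx} {γ δ : Sub} {t : Tm} {A : Ty} →
       Γ ⊢t t ∶ A → Δ ⊢s γ ∶ Γ → Θ ⊢s δ ∶ Δ → (t [ γ ]t) [ δ ]t ≡ t [ γ ∘ δ ]t)

IsProp : Set → Set
IsProp X = (p q : X) → p ≡ q

UniqueDerivations : Set
UniqueDerivations =
  ((Γ : Ctx) → IsProp (Γ ⊢C))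
  × ((Γ : Ctx) (A : Ty) → IsProp (Γ ⊢T A))
  × ((Γ : Ctx) (t : Tm) (A : Ty) → IsProp (Γ ⊢t t ∶ A))
  × ((Δ : Ctx) (γ : Sub) (Γ : Ctx) → IsProp (Δ ⊢s γ ∶ Γ))

SpheresClassify : Set
SpheresClassify =
  (Γ : Ctx) →
  Σ[ e ∈ (Σ[ n ∈ ℕ ] SubD Γ (𝕊 n)) ↔ TyD Γ ]
    ((n : ℕ) (γ : Sub) (p : Γ ⊢s γ ∶ 𝕊 n) →
       proj₁ (Inverse.to e (n , γ , p)) ≡ U n [ γ ]T)

Decidability : Set
Decidability =
  ((Γ : Ctx) → Dec (Γ ⊢C))
  × ((Γ : Ctx) (A : Ty) → Dec (Γ ⊢T A))
  × ((Γ : Ctx) (t : Tm) (A : Ty) → Dec (Γ ⊢t t ∶ A))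
  × ((Δ : Ctx) (γ : Sub) (Γ : Ctx) → Dec (Δ ⊢s γ ∶ Γ))

{-# OPTIONS --safe #-}
{-# OPTIONS --without-K #-}
module Submission where

-- Every derivable judgement mentions only variables below the length of its
-- context, and a derivable substitution into Γ binds exactly the names
-- 0, …, ℓ(Γ) − 1.  Substitution acts on such scoped syntax only through these
-- names, which gives weakening, the action of substitutions and the equations
-- of a category with families.  Raw syntax has decidable equality, hence UIP,
-- and with it every derivation is determined by its judgement; the rules are
-- syntax-directed, which gives a decision procedure.  A derivable type
-- ⇒(A, t, u) unfolds recursively into a substitution into a sphere, and
-- conversely U_n[γ] determines n as its dimension and γ through its iterated
-- sources and targets.

open import Data.Product using (_×_)
open import Defs

open import Axiom.UniquenessOfIdentityProofs using (UIP; module Decidable⇒UIP)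
open import Data.Bool using (Bool; true; false)
open import Data.Bool.Properties using (T-irrelevant)
open import Data.Empty using (⊥-elim)
open import Data.Nat using (ℕ; zero; suc; _*_; _<_; _≤_; _≡ᵇ_)
open import Data.Nat.Properties
  using (_≟_; ≤-trans; ≤-refl; ≤-pred; <⇒≢; ≤∧≢⇒<; n≤1+n; n<1+n; m≤n⇒m≤1+n; *-suc)
  renaming (≡-irrelevant to ℕ-≡-irrelevant)
open import Data.Product using (Σ; Σ-syntax; _,_; proj₁; proj₂)
open import Data.Product.Properties using (,-injectiveʳ-UIP) renaming (≡-dec to Σ-≡-dec)
open import Data.Sum using (_⊎_; inj₁; inj₂)
open import Data.Unit using (⊤; tt)
open import Function.Bundles using (mk↔ₛ′)
open import Relation.Binary.Definitions using (DecidableEquality)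
open import Relation.Binary.PropositionalEquality
  using (_≡_; _≢_; refl; sym; trans; cong; cong₂; subst; subst₂; module ≡-Reasoning)
open import Relation.Nullary using (Dec; yes; no; ¬_)

SList-≡-dec : {X : Set} → DecidableEquality X → DecidableEquality (SList X)
SList-≡-dec _≟X_ nil      nil      = yes refl
SList-≡-dec _≟X_ nil      (_ :: _) = no λ ()
SList-≡-dec _≟X_ (_ :: _) nil      = no λ ()
SList-≡-dec _≟X_ (L :: x) (M :: y) with SList-≡-dec _≟X_ L M | x ≟X y
... | yes refl | yes refl = yes refl
... | no L≢M   | _        = no λ { refl → L≢M refl }
... | yes _    | no x≢y   = no λ { refl → x≢y refl }

infix 4 _≟GTy_ _≟GCtx_

_≟GTy_ : DecidableEquality GTy
g⋆       ≟GTy g⋆       = yes refl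
g⋆       ≟GTy g⇒ _ _ _ = no λ ()
g⇒ _ _ _ ≟GTy g⋆       = no λ ()
g⇒ A (gVar x) (gVar y) ≟GTy g⇒ A′ (gVar x′) (gVar y′) with A ≟GTy A′ | x ≟ x′ | y ≟ y′
... | yes refl | yes refl | yes refl = yes refl
... | no A≢A′  | _        | _        = no λ { refl → A≢A′ refl }
... | yes _    | no x≢x′  | _        = no λ { refl → x≢x′ refl }
... | yes _    | yes _    | no y≢y′  = no λ { refl → y≢y′ refl }

_≟GCtx_ : DecidableEquality GCtx
_≟GCtx_ = SList-≡-dec (Σ-≡-dec _≟_ _≟GTy_)

uip-GCtx : UIP GCtx
uip-GCtx = Decidable⇒UIP.≡-irrelevant _≟GCtx_

PsDerivation : Set
PsDerivation = Σ (GCtx × ℕ × GTy) λ (Γ , x , A) → Γ ⊢ps x ∶ A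

ps-≡-dec : {Γ Γ′ : GCtx} {x x′ : ℕ} {A A′ : GTy}
           (d : Γ ⊢ps x ∶ A) (d′ : Γ′ ⊢ps x′ ∶ A′) →
           Dec (_≡_ {A = PsDerivation} ((Γ , x , A) , d) ((Γ′ , x′ , A′) , d′))
ps-≡-dec pss       pss         = yes refl
ps-≡-dec pss       (psd _)     = no λ ()
ps-≡-dec pss       (pse _ _)   = no λ ()
ps-≡-dec (psd _)   pss         = no λ ()
ps-≡-dec (psd _)   (pse _ _)   = no λ ()
ps-≡-dec (pse _ _) pss         = no λ ()
ps-≡-dec (pse _ _) (psd _)     = no λ ()
ps-≡-dec (psd d)   (psd d′) with ps-≡-dec d d′
... | yes refl = yes refl
... | no d≢d′  = no λ { refl → d≢d′ refl }
ps-≡-dec (pse {l = l} d e) (pse {l = l′} d′ e′) with ps-≡-dec d d′ | l ≟ l′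
... | yes refl | yes refl = yes (cong (λ e → _ , pse d e) (ℕ-≡-irrelevant e e′))
... | no d≢d′  | _        = no λ { refl → d≢d′ refl }
... | yes _    | no l≢l′  = no λ { refl → l≢l′ refl }

⊢ps-≡-dec : {Γ : GCtx} → DecidableEquality (Γ ⊢ps)
⊢ps-≡-dec (ps d) (ps d′) with ps-≡-dec d d′
... | yes e   = yes (,-injectiveʳ-UIP uip-GCtx (toPsContext e))
  where
  toPsContext : ∀ {Γ Γ′ x x′} {d : Γ ⊢ps x ∶ g⋆} {d′ : Γ′ ⊢ps x′ ∶ g⋆} →
                _≡_ {A = PsDerivation} (_ , d) (_ , d′) →
                _≡_ {A = Σ GCtx _⊢ps} (Γ , ps d) (Γ′ , ps d′)
  toPsContext refl = refl
... | no d≢d′ = no λ { refl → d≢d′ refl }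

⊆-irrelevant : (L M : SList ℕ) (p q : L ⊆ M) → p ≡ q
⊆-irrelevant nil      M tt      tt      = refl
⊆-irrelevant (L :: x) M (p , a) (q , b) = cong₂ _,_ (⊆-irrelevant L M p q) (T-irrelevant a b)

≐-irrelevant : (L M : SList ℕ) (p q : L ≐ M) → p ≡ q
≐-irrelevant L M (p , a) (q , b) = cong₂ _,_ (⊆-irrelevant L M p q) (⊆-irrelevant M L a b)

-- A type may be full both as an operation (Cop) and as a coherence (Ccoh), and
-- the two witnesses give distinct elements of J; without K, isOp is what tells
-- them apart, as mkJ cannot be inverted in its last argument.
isOp : J → Bool
isOp (mkJ _ _ ⋆         _)        = false
isOp (mkJ _ _ (⇒ _ _ _) (inj₁ _)) = true
isOp (mkJ _ _ (⇒ _ _ _) (inj₂ _)) = false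

mkJ-≡-dec : ∀ Γ d A (w w′ : Full Γ d A) → Dec (mkJ Γ d A w ≡ mkJ Γ d A w′)
mkJ-≡-dec Γ d ⋆ w w′ = yes (cong (mkJ Γ d ⋆) (≐-irrelevant _ _ w w′))
mkJ-≡-dec Γ d (⇒ B t u) (inj₁ (p , p′)) (inj₁ (q , q′)) =
  yes (cong (λ w → mkJ Γ d (⇒ B t u) (inj₁ w))
            (cong₂ _,_ (≐-irrelevant _ _ p q) (≐-irrelevant _ _ p′ q′)))
mkJ-≡-dec Γ d (⇒ B t u) (inj₂ p) (inj₂ q) =
  yes (cong (λ w → mkJ Γ d (⇒ B t u) (inj₂ w)) (≐-irrelevant _ _ p q))
mkJ-≡-dec Γ d (⇒ B t u) (inj₁ _) (inj₂ _) = no λ e → op≢coh (cong isOp e)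
  where op≢coh : true ≢ false
        op≢coh ()
mkJ-≡-dec Γ d (⇒ B t u) (inj₂ _) (inj₁ _) = no λ e → coh≢op (cong isOp e)
  where coh≢op : false ≢ true
        coh≢op ()

psContext : J → Σ GCtx _⊢ps
psContext (mkJ Γ d _ _) = Γ , d

infix 4 _≟Ty_ _≟Tm_ _≟Sub_ _≟J_

mutual
  _≟Ty_ : DecidableEquality Ty
  ⋆       ≟Ty ⋆       = yes refl
  ⋆       ≟Ty ⇒ _ _ _ = no λ ()
  ⇒ _ _ _ ≟Ty ⋆       = no λ ()
  ⇒ A t u ≟Ty ⇒ A′ t′ u′ with A ≟Ty A′ | t ≟Tm t′ | u ≟Tm u′
  ... | yes refl | yes refl | yes refl = yes refl
  ... | no A≢A′  | _        | _        = no λ { refl → A≢A′ refl }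
  ... | yes _    | no t≢t′  | _        = no λ { refl → t≢t′ refl }
  ... | yes _    | yes _    | no u≢u′  = no λ { refl → u≢u′ refl }

  _≟Tm_ : DecidableEquality Tm
  Var x   ≟Tm Var y with x ≟ y
  ... | yes refl = yes refl
  ... | no x≢y   = no λ { refl → x≢y refl }
  Var _   ≟Tm c _ _ = no λ ()
  c _ _   ≟Tm Var _ = no λ ()
  c j γ   ≟Tm c j′ γ′ with j ≟J j′ | γ ≟Sub γ′
  ... | yes refl | yes refl = yes refl
  ... | no j≢j′  | _        = no λ { refl → j≢j′ refl }
  ... | yes _    | no γ≢γ′  = no λ { refl → γ≢γ′ refl }

  _≟Sub_ : DecidableEquality Sub
  nil ≟Sub nil      = yes refl
  nil ≟Sub (_ :: _) = no λ ()
  (_ :: _) ≟Sub nil = no λ ()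
  (γ :: (x , t)) ≟Sub (γ′ :: (x′ , t′)) with γ ≟Sub γ′ | x ≟ x′ | t ≟Tm t′
  ... | yes refl | yes refl | yes refl = yes refl
  ... | no γ≢γ′  | _        | _        = no λ { refl → γ≢γ′ refl }
  ... | yes _    | no x≢x′  | _        = no λ { refl → x≢x′ refl }
  ... | yes _    | yes _    | no t≢t′  = no λ { refl → t≢t′ refl }

  _≟J_ : DecidableEquality J
  mkJ Γ d A w ≟J mkJ Γ′ d′ A′ w′ with Γ ≟GCtx Γ′
  ... | no Γ≢Γ′ = no λ { refl → Γ≢Γ′ refl }
  ... | yes refl with ⊢ps-≡-dec d d′
  ...   | no d≢d′ = no λ e → d≢d′ (,-injectiveʳ-UIP uip-GCtx (cong psContext e))
  ...   | yes refl with A ≟Ty A′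
  ...     | no A≢A′ = no λ e → A≢A′ (cong Tj e)
  ...     | yes refl = mkJ-≡-dec Γ d A w w′

uip-Ty : UIP Ty
uip-Ty = Decidable⇒UIP.≡-irrelevant _≟Ty_

uip-ℕ×Ty : UIP (ℕ × Ty)
uip-ℕ×Ty = Decidable⇒UIP.≡-irrelevant (Σ-≡-dec _≟_ _≟Ty_)

⇒-cong : {A A′ : Ty} {t t′ u u′ : Tm} → A ≡ A′ → t ≡ t′ → u ≡ u′ → ⇒ A t u ≡ ⇒ A′ t′ u′
⇒-cong refl refl refl = refl

⇒-injective : {A A′ : Ty} {t t′ u u′ : Tm} → ⇒ A t u ≡ ⇒ A′ t′ u′ → A ≡ A′ × t ≡ t′ × u ≡ u′
⇒-injective refl = refl , refl , refl

::-cong : {γ γ′ : Sub} {x : ℕ} {t t′ : Tm} → γ ≡ γ′ → t ≡ t′ → γ :: (x , t) ≡ γ′ :: (x , t′)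
::-cong refl refl = refl

mutual
  ScopedTy : ℕ → Ty → Set
  ScopedTy n ⋆         = ⊤
  ScopedTy n (⇒ A t u) = ScopedTy n A × ScopedTm n t × ScopedTm n u

  ScopedTm : ℕ → Tm → Set
  ScopedTm n (Var x) = x < n
  ScopedTm n (c _ γ) = ScopedSub n γ

  ScopedSub : ℕ → Sub → Set
  ScopedSub n nil            = ⊤
  ScopedSub n (γ :: (_ , t)) = ScopedSub n γ × ScopedTm n t

mutual
  ScopedTy-mono : ∀ {m n} A → m ≤ n → ScopedTy m A → ScopedTy n A
  ScopedTy-mono ⋆         m≤n _              = tt
  ScopedTy-mono (⇒ A t u) m≤n (sA , st , su) =
    ScopedTy-mono A m≤n sA , ScopedTm-mono t m≤n st , ScopedTm-mono u m≤n su

  ScopedTm-mono : ∀ {m n} t → m ≤ n → ScopedTm m t → ScopedTm n t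
  ScopedTm-mono (Var x) m≤n x<m = ≤-trans x<m m≤n
  ScopedTm-mono (c _ γ) m≤n sγ  = ScopedSub-mono γ m≤n sγ

  ScopedSub-mono : ∀ {m n} γ → m ≤ n → ScopedSub m γ → ScopedSub n γ
  ScopedSub-mono nil            m≤n _         = tt
  ScopedSub-mono (γ :: (_ , t)) m≤n (sγ , st) = ScopedSub-mono γ m≤n sγ , ScopedTm-mono t m≤n st

≡ᵇ-refl : ∀ n → (n ≡ᵇ n) ≡ true
≡ᵇ-refl zero    = refl
≡ᵇ-refl (suc n) = ≡ᵇ-refl n

≢⇒≡ᵇ-false : ∀ {m n} → m ≢ n → (m ≡ᵇ n) ≡ false
≢⇒≡ᵇ-false {zero}  {zero}  m≢n = ⊥-elim (m≢n refl)
≢⇒≡ᵇ-false {zero}  {suc n} m≢n = refl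
≢⇒≡ᵇ-false {suc m} {zero}  m≢n = refl
≢⇒≡ᵇ-false {suc m} {suc n} m≢n = ≢⇒≡ᵇ-false λ m≡n → m≢n (cong suc m≡n)

Var-[]-hit : ∀ γ y t → Var y [ γ :: (y , t) ]t ≡ t
Var-[]-hit γ y t rewrite ≡ᵇ-refl y = refl

Var-[]-miss : ∀ γ {x y} t → x ≢ y → Var x [ γ :: (y , t) ]t ≡ Var x [ γ ]t
Var-[]-miss γ t x≢y rewrite ≢⇒≡ᵇ-false x≢y = refl

Agree : ℕ → Sub → Sub → Set
Agree n γ δ = ∀ {x} → x < n → Var x [ γ ]t ≡ Var x [ δ ]t

mutual
  []T-agree : ∀ {n} A γ δ → ScopedTy n A → Agree n γ δ → A [ γ ]T ≡ A [ δ ]T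
  []T-agree ⋆         γ δ _              _ = refl
  []T-agree (⇒ A t u) γ δ (sA , st , su) ag =
    ⇒-cong ([]T-agree A γ δ sA ag) ([]t-agree t γ δ st ag) ([]t-agree u γ δ su ag)

  []t-agree : ∀ {n} t γ δ → ScopedTm n t → Agree n γ δ → t [ γ ]t ≡ t [ δ ]t
  []t-agree (Var x) γ δ x<n ag = ag x<n
  []t-agree (c j σ) γ δ sσ  ag = cong (c j) (∘-agree σ γ δ sσ ag)

  ∘-agree : ∀ {n} σ γ δ → ScopedSub n σ → Agree n γ δ → σ ∘ γ ≡ σ ∘ δ
  ∘-agree nil            γ δ _         _  = refl
  ∘-agree (σ :: (_ , t)) γ δ (sσ , st) ag = ::-cong (∘-agree σ γ δ sσ ag) ([]t-agree t γ δ st ag)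

Agree-:: : ∀ {n y} γ t → n ≤ y → Agree n (γ :: (y , t)) γ
Agree-:: γ t n≤y x<n = Var-[]-miss γ t (<⇒≢ (≤-trans x<n n≤y))

[]T-:: : ∀ {n y} A γ t → ScopedTy n A → n ≤ y → A [ γ :: (y , t) ]T ≡ A [ γ ]T
[]T-:: A γ t sA n≤y = []T-agree A (γ :: (_ , t)) γ sA (Agree-:: γ t n≤y)

Var-[id] : ∀ Γ x → Var x [ id Γ ]t ≡ Var x
Var-[id] nil            x = refl
Var-[id] (Γ :: (y , _)) x with x ≟ y
... | yes refl = Var-[]-hit (id Γ) x (Var x)
... | no x≢y   = trans (Var-[]-miss (id Γ) (Var y) x≢y) (Var-[id] Γ x)

mutual
  [id]T : ∀ Γ A → A [ id Γ ]T ≡ A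
  [id]T Γ ⋆         = refl
  [id]T Γ (⇒ A t u) = ⇒-cong ([id]T Γ A) ([id]t Γ t) ([id]t Γ u)

  [id]t : ∀ Γ t → t [ id Γ ]t ≡ t
  [id]t Γ (Var x) = Var-[id] Γ x
  [id]t Γ (c j σ) = cong (c j) (∘-identityʳ Γ σ)

  ∘-identityʳ : ∀ Γ σ → σ ∘ id Γ ≡ σ
  ∘-identityʳ Γ nil            = refl
  ∘-identityʳ Γ (σ :: (_ , t)) = ::-cong (∘-identityʳ Γ σ) ([id]t Γ t)

names : {X : Set} → SList (ℕ × X) → SList ℕ
names nil            = nil
names (L :: (x , _)) = names L :: x

upTo : ℕ → SList ℕ
upTo zero    = nil
upTo (suc n) = upTo n :: n

<⇒∈upTo : ∀ {x n} → x < n → x ∈ upTo n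
<⇒∈upTo {x} {suc n} x<1+n with x ≟ n
... | yes refl = here
... | no x≢n   = there (<⇒∈upTo (≤∧≢⇒< (≤-pred x<1+n) x≢n))

∈-::⁻ : {X : Set} {a b : X} {L : SList X} → a ∈ (L :: b) → a ≡ b ⊎ a ∈ L
∈-::⁻ here      = inj₁ refl
∈-::⁻ (there m) = inj₂ m

∈-::⁺ : {X : Set} {a b : X} {L : SList X} → a ≡ b ⊎ a ∈ L → a ∈ (L :: b)
∈-::⁺ (inj₁ refl) = here
∈-::⁺ (inj₂ m)    = there m

∈-::⁺∘⁻ : {X : Set} {a b : X} {L : SList X} (m : a ∈ (L :: b)) → ∈-::⁺ (∈-::⁻ m) ≡ m
∈-::⁺∘⁻ here      = refl
∈-::⁺∘⁻ (there m) = refl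

∈-::-≢ : {X : Set} {a b : X} {L : SList X} → a ∈ (L :: b) → a ≢ b → a ∈ L
∈-::-≢ here      a≢b = ⊥-elim (a≢b refl)
∈-::-≢ (there m) _   = m

Covers : ℕ → Sub → Set
Covers n γ = ∀ {x} → x < n → x ∈ names γ

Var-[][] : ∀ γ δ {x} → x ∈ names γ → (Var x [ γ ]t) [ δ ]t ≡ Var x [ γ ∘ δ ]t
Var-[][] (γ :: (y , t)) δ {x} x∈γ with x ≟ y
... | yes refl = begin
  (Var x [ γ :: (x , t) ]t) [ δ ]t  ≡⟨ cong (_[ δ ]t) (Var-[]-hit γ x t) ⟩
  t [ δ ]t                          ≡⟨ sym (Var-[]-hit (γ ∘ δ) x (t [ δ ]t)) ⟩
  Var x [ (γ :: (x , t)) ∘ δ ]t     ∎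
  where open ≡-Reasoning
... | no x≢y = begin
  (Var x [ γ :: (y , t) ]t) [ δ ]t  ≡⟨ cong (_[ δ ]t) (Var-[]-miss γ t x≢y) ⟩
  (Var x [ γ ]t) [ δ ]t             ≡⟨ Var-[][] γ δ (∈-::-≢ x∈γ x≢y) ⟩
  Var x [ γ ∘ δ ]t                  ≡⟨ sym (Var-[]-miss (γ ∘ δ) (t [ δ ]t) x≢y) ⟩
  Var x [ (γ :: (y , t)) ∘ δ ]t     ∎
  where open ≡-Reasoning

mutual
  [][]T : ∀ {n} A γ δ → ScopedTy n A → Covers n γ → (A [ γ ]T) [ δ ]T ≡ A [ γ ∘ δ ]T
  [][]T ⋆         γ δ _              _  = refl
  [][]T (⇒ A t u) γ δ (sA , st , su) cv =
    ⇒-cong ([][]T A γ δ sA cv) ([][]t t γ δ st cv) ([][]t u γ δ su cv)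

  [][]t : ∀ {n} t γ δ → ScopedTm n t → Covers n γ → (t [ γ ]t) [ δ ]t ≡ t [ γ ∘ δ ]t
  [][]t (Var x) γ δ x<n cv = Var-[][] γ δ (cv x<n)
  [][]t (c j σ) γ δ sσ  cv = cong (c j) (∘-assoc-scoped σ γ δ sσ cv)

  ∘-assoc-scoped : ∀ {n} σ γ δ → ScopedSub n σ → Covers n γ → (σ ∘ γ) ∘ δ ≡ σ ∘ (γ ∘ δ)
  ∘-assoc-scoped nil            γ δ _         _  = refl
  ∘-assoc-scoped (σ :: (_ , t)) γ δ (sσ , st) cv =
    ::-cong (∘-assoc-scoped σ γ δ sσ cv) ([][]t t γ δ st cv)

Var-[]-scoped : ∀ {m} γ {x} → x ∈ names γ → ScopedSub m γ → ScopedTm m (Var x [ γ ]t)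
Var-[]-scoped (γ :: (y , t)) {x} x∈γ (sγ , st) with x ≟ y
... | yes refl = subst (ScopedTm _) (sym (Var-[]-hit γ x t)) st
... | no x≢y   = subst (ScopedTm _) (sym (Var-[]-miss γ t x≢y)) (Var-[]-scoped γ (∈-::-≢ x∈γ x≢y) sγ)

mutual
  []T-scoped : ∀ {n m} A γ → ScopedTy n A → Covers n γ → ScopedSub m γ → ScopedTy m (A [ γ ]T)
  []T-scoped ⋆         γ _              _  _  = tt
  []T-scoped (⇒ A t u) γ (sA , st , su) cv sγ =
    []T-scoped A γ sA cv sγ , []t-scoped t γ st cv sγ , []t-scoped u γ su cv sγ

  []t-scoped : ∀ {n m} t γ → ScopedTm n t → Covers n γ → ScopedSub m γ → ScopedTm m (t [ γ ]t)
  []t-scoped (Var x) γ x<n cv sγ = Var-[]-scoped γ (cv x<n) sγ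
  []t-scoped (c j σ) γ sσ  cv sγ = ∘-scoped σ γ sσ cv sγ

  ∘-scoped : ∀ {n m} σ γ → ScopedSub n σ → Covers n γ → ScopedSub m γ → ScopedSub m (σ ∘ γ)
  ∘-scoped nil            γ _         _  _  = tt
  ∘-scoped (σ :: (_ , t)) γ (sσ , st) cv sγ = ∘-scoped σ γ sσ cv sγ , []t-scoped t γ st cv sγ

⊢C-inv : ∀ {Γ x A} → (Γ :: (x , A)) ⊢C → Γ ⊢C × Γ ⊢T A
⊢C-inv (cc w B _) = w , B

mutual
  ⊢T-ctx : ∀ {Γ A} → Γ ⊢T A → Γ ⊢C
  ⊢T-ctx (ob w)   = w
  ⊢T-ctx (ar a _) = ⊢t-ctx a

  ⊢t-ctx : ∀ {Γ t A} → Γ ⊢t t ∶ A → Γ ⊢C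
  ⊢t-ctx (var w _) = w
  ⊢t-ctx (tm _ s)  = ⊢s-dom s

  ⊢s-dom : ∀ {Δ γ Γ} → Δ ⊢s γ ∶ Γ → Δ ⊢C
  ⊢s-dom (es w)       = w
  ⊢s-dom (sc s _ _ _) = ⊢s-dom s

⊢s-cod : ∀ {Δ γ Γ} → Δ ⊢s γ ∶ Γ → Γ ⊢C
⊢s-cod (es _)       = ec
⊢s-cod (sc _ w _ _) = w

mutual
  ⊢T-weaken : ∀ {Γ y A B} → Γ ⊢T A → (Γ :: (y , B)) ⊢C → (Γ :: (y , B)) ⊢T A
  ⊢T-weaken (ob _)   w = ob w
  ⊢T-weaken (ar a b) w = ar (⊢t-weaken a w) (⊢t-weaken b w)

  ⊢t-weaken : ∀ {Γ y B t A} → Γ ⊢t t ∶ A → (Γ :: (y , B)) ⊢C → (Γ :: (y , B)) ⊢t t ∶ A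
  ⊢t-weaken (var _ m) w = var w (there m)
  ⊢t-weaken (tm a s)  w = tm a (⊢s-weaken s w)

  ⊢s-weaken : ∀ {Δ Γ y B γ} → Δ ⊢s γ ∶ Γ → (Δ :: (y , B)) ⊢C → (Δ :: (y , B)) ⊢s γ ∶ Γ
  ⊢s-weaken (es _)        w = es w
  ⊢s-weaken (sc s wΓ d e) w = sc (⊢s-weaken s w) wΓ (⊢t-weaken d w) e

⊢C-names : ∀ {Γ} → Γ ⊢C → names Γ ≡ upTo (len Γ)
⊢C-names ec                = refl
⊢C-names (cc {Γ} w _ refl) = cong (_:: len Γ) (⊢C-names w)

⊢s-names : ∀ {Δ γ Γ} → Δ ⊢s γ ∶ Γ → names γ ≡ names Γ
⊢s-names (es _)          = refl
⊢s-names (sc s _ _ refl) = cong (_:: _) (⊢s-names s)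

⊢s-covers : ∀ {Δ γ Γ} → Δ ⊢s γ ∶ Γ → Covers (len Γ) γ
⊢s-covers s {x} x<n =
  subst (x ∈_) (sym (trans (⊢s-names s) (⊢C-names (⊢s-cod s)))) (<⇒∈upTo x<n)

mutual
  ∈-scoped : ∀ {Γ x A} → Γ ⊢C → (x , A) ∈ Γ → x < len Γ × ScopedTy (len Γ) A
  ∈-scoped (cc w B refl) here      = n<1+n _ , ScopedTy-mono _ (n≤1+n _) (⊢T-scoped B)
  ∈-scoped (cc w B refl) (there m) =
    let x<n , sA = ∈-scoped w m in m≤n⇒m≤1+n x<n , ScopedTy-mono _ (n≤1+n _) sA

  ⊢T-scoped : ∀ {Γ A} → Γ ⊢T A → ScopedTy (len Γ) A
  ⊢T-scoped (ob _)   = tt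
  ⊢T-scoped (ar a b) = proj₂ (⊢t-scoped a) , proj₁ (⊢t-scoped a) , proj₁ (⊢t-scoped b)

  ⊢t-scoped : ∀ {Γ t A} → Γ ⊢t t ∶ A → ScopedTm (len Γ) t × ScopedTy (len Γ) A
  ⊢t-scoped (var w m) = ∈-scoped w m
  ⊢t-scoped (tm {j = j} {γ = γ} a s) =
    ⊢s-scoped s , []T-scoped (Tj j) γ (⊢T-scoped a) (⊢s-covers s) (⊢s-scoped s)

  ⊢s-scoped : ∀ {Δ γ Γ} → Δ ⊢s γ ∶ Γ → ScopedSub (len Δ) γ
  ⊢s-scoped (es _)       = tt
  ⊢s-scoped (sc s _ d _) = ⊢s-scoped s , proj₁ (⊢t-scoped d)

Var-[]-⊢ : ∀ {Δ γ Γ x A} → Δ ⊢s γ ∶ Γ → (x , A) ∈ Γ → Δ ⊢t Var x [ γ ]t ∶ A [ γ ]T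
Var-[]-⊢ {Δ} (sc {γ = γ} {t = t} s (cc {Γ} w B refl) d refl) here =
  subst₂ (Δ ⊢t_∶_) (sym (Var-[]-hit γ (len Γ) t)) (sym ([]T-:: _ γ t (⊢T-scoped B) ≤-refl)) d
Var-[]-⊢ {Δ} (sc {γ = γ} {t = t} s (cc {Γ} w B refl) d refl) (there m) =
  let x<n , sA = ∈-scoped w m in
  subst₂ (Δ ⊢t_∶_) (sym (Var-[]-miss γ t (<⇒≢ x<n))) (sym ([]T-:: _ γ t sA ≤-refl)) (Var-[]-⊢ s m)

mutual
  ⊢T-[] : ∀ {Δ γ Γ A} → Δ ⊢s γ ∶ Γ → Γ ⊢T A → Δ ⊢T A [ γ ]T
  ⊢T-[] s (ob _)   = ob (⊢s-dom s)
  ⊢T-[] s (ar a b) = ar (⊢t-[] s a) (⊢t-[] s b)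

  ⊢t-[] : ∀ {Δ γ Γ t A} → Δ ⊢s γ ∶ Γ → Γ ⊢t t ∶ A → Δ ⊢t t [ γ ]t ∶ A [ γ ]T
  ⊢t-[] s (var _ m) = Var-[]-⊢ s m
  ⊢t-[] {Δ} {γ} s (tm {j = j} {γ = σ} a r) =
    subst (Δ ⊢t c j (σ ∘ γ) ∶_) (sym ([][]T (Tj j) σ γ (⊢T-scoped a) (⊢s-covers r))) (tm a (⊢s-∘ r s))

  ⊢s-∘ : ∀ {Θ Δ Γ γ δ} → Δ ⊢s γ ∶ Γ → Θ ⊢s δ ∶ Δ → Θ ⊢s γ ∘ δ ∶ Γ
  ⊢s-∘ (es _) r = es (⊢s-dom r)
  ⊢s-∘ {Θ} {δ = δ} (sc {γ = γ} {A = A} s w d e) r =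
    sc (⊢s-∘ s r) w (subst (Θ ⊢t _ ∶_) ([][]T A γ δ A-scoped (⊢s-covers s)) (⊢t-[] r d)) e
    where A-scoped = ⊢T-scoped (proj₂ (⊢C-inv w))

∈⇒⊢T : ∀ {Γ x A} → Γ ⊢C → (x , A) ∈ Γ → Γ ⊢T A
∈⇒⊢T w@(cc _ B refl) here      = ⊢T-weaken B w
∈⇒⊢T w@(cc v _ refl) (there m) = ⊢T-weaken (∈⇒⊢T v m) w

⊢t-type : ∀ {Γ t A} → Γ ⊢t t ∶ A → Γ ⊢T A
⊢t-type (var w m) = ∈⇒⊢T w m
⊢t-type (tm a s)  = ⊢T-[] s a

⊢s-id : ∀ {Γ} → Γ ⊢C → Γ ⊢s id Γ ∶ Γ
⊢s-id ec = es ec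
⊢s-id w@(cc {Γ} {A} {x} v _ _) =
  sc (⊢s-weaken (⊢s-id v) w) w (subst ((Γ :: (x , A)) ⊢t Var x ∶_) (sym ([id]T Γ A)) (var w here)) refl

∘-identityˡ : ∀ {Δ γ Γ} → Δ ⊢s γ ∶ Γ → id Γ ∘ γ ≡ γ
∘-identityˡ (es _) = refl
∘-identityˡ (sc {Γ = Γ} {γ = γ} {t = t} s (cc w _ refl) _ refl) =
  ::-cong (trans (∘-agree (id Γ) _ γ (⊢s-scoped (⊢s-id w)) (Agree-:: γ t ≤-refl)) (∘-identityˡ s))
          (Var-[]-hit γ (len Γ) t)

∘-assoc : ∀ {Ξ Θ Δ Γ γ δ θ} → Δ ⊢s γ ∶ Γ → Θ ⊢s δ ∶ Δ → Ξ ⊢s θ ∶ Θ → (γ ∘ δ) ∘ θ ≡ γ ∘ (δ ∘ θ)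
∘-assoc {γ = γ} {δ} {θ} sγ sδ _ = ∘-assoc-scoped γ δ θ (⊢s-scoped sγ) (⊢s-covers sδ)

⊢T-[][] : ∀ {Θ Δ Γ γ δ A} → Γ ⊢T A → Δ ⊢s γ ∶ Γ → Θ ⊢s δ ∶ Δ → (A [ γ ]T) [ δ ]T ≡ A [ γ ∘ δ ]T
⊢T-[][] {γ = γ} {δ} {A} a sγ _ = [][]T A γ δ (⊢T-scoped a) (⊢s-covers sγ)

⊢t-[][] : ∀ {Θ Δ Γ γ δ t A} → Γ ⊢t t ∶ A → Δ ⊢s γ ∶ Γ → Θ ⊢s δ ∶ Δ → (t [ γ ]t) [ δ ]t ≡ t [ γ ∘ δ ]t
⊢t-[][] {γ = γ} {δ} {t = t} d sγ _ = [][]t t γ δ (proj₁ (⊢t-scoped d)) (⊢s-covers sγ)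

∈-irrelevant : ∀ {Γ x A} → Γ ⊢C → (m m′ : (x , A) ∈ Γ) → m ≡ m′
∈-irrelevant {x = x} {A} (cc {Γ} {B} w _ refl) m m′ = begin
  m                    ≡⟨ sym (∈-::⁺∘⁻ m) ⟩
  ∈-::⁺ (∈-::⁻ m)      ≡⟨ cong ∈-::⁺ (cases-irrelevant (∈-::⁻ m) (∈-::⁻ m′)) ⟩
  ∈-::⁺ (∈-::⁻ m′)     ≡⟨ ∈-::⁺∘⁻ m′ ⟩
  m′                   ∎
  where
  open ≡-Reasoning
  fresh : (x , A) ≡ (len Γ , B) → ¬ (x , A) ∈ Γ
  fresh refl n = <⇒≢ (proj₁ (∈-scoped w n)) refl
  cases-irrelevant : (u v : (x , A) ≡ (len Γ , B) ⊎ (x , A) ∈ Γ) → u ≡ v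
  cases-irrelevant (inj₁ e) (inj₁ e′) = cong inj₁ (uip-ℕ×Ty e e′)
  cases-irrelevant (inj₂ n) (inj₂ n′) = cong inj₂ (∈-irrelevant w n n′)
  cases-irrelevant (inj₁ e) (inj₂ n)  = ⊥-elim (fresh e n)
  cases-irrelevant (inj₂ n) (inj₁ e)  = ⊥-elim (fresh e n)

-- The type index Tj j [ γ ]T of rule (tm) is not a pattern, so without K two
-- derivations of a coherence term are compared through their premises,
-- using UIP for the decidable type Ty.
Premises : Ctx → Tm → Ty → Set
Premises Δ (Var x) A = Δ ⊢C × (x , A) ∈ Δ
Premises Δ (c j γ) A = C j ⊢T Tj j × Δ ⊢s γ ∶ C j × Tj j [ γ ]T ≡ A

premises : ∀ {Δ t A} → Δ ⊢t t ∶ A → Premises Δ t A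
premises (var w m) = w , m
premises (tm a s)  = a , s , refl

fromPremises : ∀ {Δ} t {A} → Premises Δ t A → Δ ⊢t t ∶ A
fromPremises     (Var x) (w , m)     = var w m
fromPremises {Δ} (c j γ) (a , s , e) = subst (Δ ⊢t c j γ ∶_) e (tm a s)

fromPremises∘premises : ∀ {Δ t A} (d : Δ ⊢t t ∶ A) → fromPremises t (premises d) ≡ d
fromPremises∘premises (var _ _) = refl
fromPremises∘premises (tm _ _)  = refl

tm-≡-fromPremises : ∀ {Δ j γ} (a : C j ⊢T Tj j) (s : Δ ⊢s γ ∶ C j)
                    (p : Premises Δ (c j γ) (Tj j [ γ ]T)) →
                    (∀ a′ → a ≡ a′) → (∀ s′ → s ≡ s′) → tm a s ≡ fromPremises (c j γ) p
tm-≡-fromPremises a s (a′ , s′ , e) a≡ s≡ with uip-Ty e refl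
... | refl = cong₂ tm (a≡ a′) (s≡ s′)

mutual
  ⊢C-irrelevant : ∀ {Γ} (w w′ : Γ ⊢C) → w ≡ w′
  ⊢C-irrelevant ec ec = refl
  ⊢C-irrelevant (cc w a e) (cc w′ a′ e′)
    with ⊢C-irrelevant w w′ | ⊢T-irrelevant a a′ | ℕ-≡-irrelevant e e′
  ... | refl | refl | refl = refl

  ⊢T-irrelevant : ∀ {Γ A} (a a′ : Γ ⊢T A) → a ≡ a′
  ⊢T-irrelevant (ob w)   (ob w′)    = cong ob (⊢C-irrelevant w w′)
  ⊢T-irrelevant (ar d e) (ar d′ e′) = cong₂ ar (⊢t-irrelevant d d′) (⊢t-irrelevant e e′)

  ⊢t-irrelevant : ∀ {Γ t A} (d d′ : Γ ⊢t t ∶ A) → d ≡ d′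
  ⊢t-irrelevant (var w m) (var w′ m′) = cong₂ var (⊢C-irrelevant w w′) (∈-irrelevant w m m′)
  ⊢t-irrelevant (tm a s)  d′ =
    trans (tm-≡-fromPremises a s (premises d′) (⊢T-irrelevant a) (⊢s-irrelevant s))
          (fromPremises∘premises d′)

  ⊢s-irrelevant : ∀ {Δ γ Γ} (s s′ : Δ ⊢s γ ∶ Γ) → s ≡ s′
  ⊢s-irrelevant (es w) (es w′) = cong es (⊢C-irrelevant w w′)
  ⊢s-irrelevant (sc s w d e) (sc s′ w′ d′ e′)
    with ⊢s-irrelevant s s′ | ⊢C-irrelevant w w′ | ⊢t-irrelevant d d′ | ℕ-≡-irrelevant e e′
  ... | refl | refl | refl | refl = refl

∈-dec : {X : Set} → DecidableEquality X → (a : X) (L : SList X) → Dec (a ∈ L)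
∈-dec _≟X_ a nil = no λ ()
∈-dec _≟X_ a (L :: b) with a ≟X b
... | yes refl = yes here
... | no a≢b with ∈-dec _≟X_ a L
...   | yes m  = yes (there m)
...   | no a∉L = no λ m → a∉L (∈-::-≢ m a≢b)

⊢Var?-in : ∀ {Γ} → Γ ⊢C → (x : ℕ) (A : Ty) → Dec (Γ ⊢t Var x ∶ A)
⊢Var?-in {Γ} w x A with ∈-dec (Σ-≡-dec _≟_ _≟Ty_) (x , A) Γ
... | yes m = yes (var w m)
... | no ∉Γ = no λ { (var _ m) → ∉Γ m }

-- C j is not a subterm of c j γ; it is checked separately, which is possible
-- because Glob contexts contain variables only.
embTy?-in : ∀ {Γ} → Γ ⊢C → (A : GTy) → Dec (Γ ⊢T embTy A)
embTy?-in w g⋆ = yes (ob w)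
embTy?-in w (g⇒ A (gVar x) (gVar y)) with ⊢Var?-in w x (embTy A) | ⊢Var?-in w y (embTy A)
... | yes d | yes e = yes (ar d e)
... | no ¬d | _     = no λ { (ar d _) → ¬d d }
... | yes _ | no ¬e = no λ { (ar _ e) → ¬e e }

embC? : (Γ : GCtx) → Dec (embC Γ ⊢C)
embC? nil = yes ec
embC? (Γ :: (x , A)) with embC? Γ
... | no ¬w = no λ w → ¬w (proj₁ (⊢C-inv w))
... | yes w with embTy?-in w A | x ≟ len (embC Γ)
...   | yes a | yes e = yes (cc w a e)
...   | no ¬a | _     = no λ w → ¬a (proj₂ (⊢C-inv w))
...   | yes _ | no x≢ = no λ { (cc _ _ e) → x≢ e }

mutual
  ⊢T?-in : ∀ {Γ} → Γ ⊢C → (A : Ty) → Dec (Γ ⊢T A)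
  ⊢T?-in w ⋆ = yes (ob w)
  ⊢T?-in w (⇒ A t u) with ⊢t?-in w t A | ⊢t?-in w u A
  ... | yes d | yes e = yes (ar d e)
  ... | no ¬d | _     = no λ { (ar d _) → ¬d d }
  ... | yes _ | no ¬e = no λ { (ar _ e) → ¬e e }

  ⊢t?-in : ∀ {Γ} → Γ ⊢C → (t : Tm) (A : Ty) → Dec (Γ ⊢t t ∶ A)
  ⊢t?-in w (Var x) A = ⊢Var?-in w x A
  ⊢t?-in w (c j@(mkJ Γ d B f) γ) A with embC? Γ
  ... | no ¬wΓ = no λ d → ¬wΓ (⊢T-ctx (proj₁ (premises d)))
  ... | yes wΓ with ⊢T?-in wΓ B | ⊢s?-in w wΓ γ | B [ γ ]T ≟Ty A
  ...   | yes a | yes s | yes e = yes (fromPremises (c j γ) (a , s , e))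
  ...   | no ¬a | _     | _     = no λ d → ¬a (proj₁ (premises d))
  ...   | yes _ | no ¬s | _     = no λ d → ¬s (proj₁ (proj₂ (premises d)))
  ...   | yes _ | yes _ | no ¬e = no λ d → ¬e (proj₂ (proj₂ (premises d)))

  ⊢s?-in : ∀ {Δ Γ} → Δ ⊢C → Γ ⊢C → (γ : Sub) → Dec (Δ ⊢s γ ∶ Γ)
  ⊢s?-in w ec           nil      = yes (es w)
  ⊢s?-in w ec           (_ :: _) = no λ ()
  ⊢s?-in w (cc _ _ _)   nil      = no λ ()
  ⊢s?-in w wΓ@(cc {A = A} {x = x} v _ _) (γ :: (y , t))
    with ⊢s?-in w v γ | ⊢t?-in w t (A [ γ ]T) | x ≟ y
  ... | yes s | yes d | yes e = yes (sc s wΓ d e)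
  ... | no ¬s | _     | _     = no λ { (sc s _ _ _) → ¬s s }
  ... | yes _ | no ¬d | _     = no λ { (sc _ _ d _) → ¬d d }
  ... | yes _ | yes _ | no x≢ = no λ { (sc _ _ _ e) → x≢ e }

⊢C? : (Γ : Ctx) → Dec (Γ ⊢C)
⊢C? nil = yes ec
⊢C? (Γ :: (x , A)) with ⊢C? Γ
... | no ¬w = no λ w → ¬w (proj₁ (⊢C-inv w))
... | yes w with ⊢T?-in w A | x ≟ len Γ
...   | yes a | yes e = yes (cc w a e)
...   | no ¬a | _     = no λ w → ¬a (proj₂ (⊢C-inv w))
...   | yes _ | no x≢ = no λ { (cc _ _ e) → x≢ e }

⊢T? : (Γ : Ctx) (A : Ty) → Dec (Γ ⊢T A)
⊢T? Γ A with ⊢C? Γ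
... | yes w = ⊢T?-in w A
... | no ¬w = no λ a → ¬w (⊢T-ctx a)

⊢t? : (Γ : Ctx) (t : Tm) (A : Ty) → Dec (Γ ⊢t t ∶ A)
⊢t? Γ t A with ⊢C? Γ
... | yes w = ⊢t?-in w t A
... | no ¬w = no λ d → ¬w (⊢t-ctx d)

⊢s? : (Δ : Ctx) (γ : Sub) (Γ : Ctx) → Dec (Δ ⊢s γ ∶ Γ)
⊢s? Δ γ Γ with ⊢C? Δ | ⊢C? Γ
... | yes w | yes wΓ = ⊢s?-in w wΓ γ
... | no ¬w | _      = no λ s → ¬w (⊢s-dom s)
... | yes _ | no ¬wΓ = no λ s → ¬wΓ (⊢s-cod s)

len-𝕊 : ∀ n → len (𝕊 n) ≡ 2 * n
len-𝕊 zero    = refl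
len-𝕊 (suc n) = trans (cong (λ k → suc (suc k)) (len-𝕊 n)) (sym (*-suc 2 n))

mutual
  𝔻-⊢C : ∀ n → 𝔻 n ⊢C
  𝔻-⊢C n = cc (proj₁ (𝕊-⊢ n)) (proj₂ (𝕊-⊢ n)) refl

  𝕊-⊢ : ∀ n → 𝕊 n ⊢C × 𝕊 n ⊢T U n
  𝕊-⊢ zero    = ec , ob ec
  𝕊-⊢ (suc n) = w , ar (var w src) (var w tgt)
    where
    w : 𝕊 (suc n) ⊢C
    w = cc (𝔻-⊢C n) (⊢T-weaken (proj₂ (𝕊-⊢ n)) (𝔻-⊢C n)) refl
    src : (2 * n , U n) ∈ 𝕊 (suc n)
    src = subst (λ k → (k , U n) ∈ 𝕊 (suc n)) (len-𝕊 n) (there here)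
    tgt : (suc (2 * n) , U n) ∈ 𝕊 (suc n)
    tgt = subst (λ k → (suc k , U n) ∈ 𝕊 (suc n)) (len-𝕊 n) here

U-scoped : ∀ n → ScopedTy (len (𝕊 n)) (U n)
U-scoped n = ⊢T-scoped (proj₂ (𝕊-⊢ n))

U-suc-[] : ∀ n γ t u → U (suc n) [ (γ :: (len (𝕊 n) , t)) :: (len (𝔻 n) , u) ]T ≡ ⇒ (U n [ γ ]T) t u
U-suc-[] n γ t u = ⇒-cong base src tgt
  where
  k  = len (𝕊 n)
  γ₁ = γ :: (k , t)
  base : U n [ γ₁ :: (suc k , u) ]T ≡ U n [ γ ]T
  base = trans ([]T-:: (U n) γ₁ u (U-scoped n) (n≤1+n k)) ([]T-:: (U n) γ t (U-scoped n) ≤-refl)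
  src : Var (2 * n) [ γ₁ :: (suc k , u) ]t ≡ t
  src = subst (λ x → Var x [ γ₁ :: (suc k , u) ]t ≡ t) (len-𝕊 n)
              (trans (Var-[]-miss γ₁ u (<⇒≢ (n<1+n k))) (Var-[]-hit γ k t))
  tgt : Var (suc (2 * n)) [ γ₁ :: (suc k , u) ]t ≡ u
  tgt = subst (λ x → Var (suc x) [ γ₁ :: (suc k , u) ]t ≡ u) (len-𝕊 n) (Var-[]-hit γ₁ (suc k) u)

dim : Ty → ℕ
dim ⋆         = 0
dim (⇒ A _ _) = suc (dim A)

dim-U-[] : ∀ n γ → dim (U n [ γ ]T) ≡ n
dim-U-[] zero    γ = refl
dim-U-[] (suc n) γ = cong suc (dim-U-[] n γ)

SphereSub : Ctx → Set
SphereSub Γ = Σ[ n ∈ ℕ ] SubD Γ (𝕊 n)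

toTyD : ∀ {Γ} → SphereSub Γ → TyD Γ
toTyD (n , γ , s) = U n [ γ ]T , ⊢T-[] s (proj₂ (𝕊-⊢ n))

unfold : ∀ {Γ} A → Γ ⊢T A → Σ (SphereSub Γ) λ (n , γ , _) → U n [ γ ]T ≡ A
unfold ⋆ (ob w) = (0 , nil , es w) , refl
unfold {Γ} (⇒ A t u) (ar d e) with unfold A (⊢t-type d)
... | (n , γ , s) , U[γ]≡A = (suc n , γ₂ , s₂) , trans (U-suc-[] n γ t u) (cong (λ B → ⇒ B t u) U[γ]≡A)
  where
  γ₁ = γ :: (len (𝕊 n) , t)
  γ₂ = γ₁ :: (len (𝔻 n) , u)
  U[γ₁]≡A : U n [ γ₁ ]T ≡ A
  U[γ₁]≡A = trans ([]T-:: (U n) γ t (U-scoped n) ≤-refl) U[γ]≡A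
  s₁ : Γ ⊢s γ₁ ∶ 𝔻 n
  s₁ = sc s (𝔻-⊢C n) (subst (Γ ⊢t t ∶_) (sym U[γ]≡A) d) refl
  s₂ : Γ ⊢s γ₂ ∶ 𝕊 (suc n)
  s₂ = sc s₁ (proj₁ (𝕊-⊢ (suc n))) (subst (Γ ⊢t u ∶_) (sym U[γ₁]≡A) e) refl

U-[]-injective : ∀ {Γ} n {γ δ} → Γ ⊢s γ ∶ 𝕊 n → Γ ⊢s δ ∶ 𝕊 n → U n [ γ ]T ≡ U n [ δ ]T → γ ≡ δ
U-[]-injective zero (es _) (es _) _ = refl
U-[]-injective (suc n) (sc {t = u} (sc {γ = γ} {t = t} s _ _ refl) _ _ refl)
                       (sc {t = u′} (sc {γ = δ} {t = t′} r _ _ refl) _ _ refl) e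
  with ⇒-injective (trans (sym (U-suc-[] n γ t u)) (trans e (U-suc-[] n δ t′ u′)))
... | U[γ]≡U[δ] , refl , refl with U-[]-injective n s r U[γ]≡U[δ]
...   | refl = refl

SphereSub-≡ : ∀ {Γ n m γ δ} (s : Γ ⊢s γ ∶ 𝕊 n) (r : Γ ⊢s δ ∶ 𝕊 m) →
              n ≡ m → U n [ γ ]T ≡ U m [ δ ]T → _≡_ {A = SphereSub Γ} (n , γ , s) (m , δ , r)
SphereSub-≡ {n = n} s r refl U[γ]≡U[δ] with U-[]-injective n s r U[γ]≡U[δ]
... | refl = cong (λ r → n , _ , r) (⊢s-irrelevant s r)

toTyD-injective : ∀ {Γ} (x y : SphereSub Γ) → toTyD x ≡ toTyD y → x ≡ y
toTyD-injective (n , γ , s) (m , δ , r) e =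
  SphereSub-≡ s r (trans (sym (dim-U-[] n γ)) (trans (cong dim U[γ]≡U[δ]) (dim-U-[] m δ))) U[γ]≡U[δ]
  where U[γ]≡U[δ] = cong proj₁ e

TyD-≡ : ∀ {Γ A A′} {a : Γ ⊢T A} {a′ : Γ ⊢T A′} → A ≡ A′ → _≡_ {A = TyD Γ} (A , a) (A′ , a′)
TyD-≡ {a = a} {a′} refl = cong (_ ,_) (⊢T-irrelevant a a′)

spheres-classify : SpheresClassify
spheres-classify Γ = mk↔ₛ′ toTyD fromTyD toTyD∘fromTyD fromTyD∘toTyD , λ _ _ _ → refl
  where
  fromTyD : TyD Γ → SphereSub Γ
  fromTyD (A , a) = proj₁ (unfold A a)
  toTyD∘fromTyD : ∀ y → toTyD (fromTyD y) ≡ y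
  toTyD∘fromTyD (A , a) = TyD-≡ (proj₂ (unfold A a))
  fromTyD∘toTyD : ∀ x → fromTyD (toTyD x) ≡ x
  fromTyD∘toTyD x = toTyD-injective (fromTyD (toTyD x)) x (toTyD∘fromTyD (toTyD x))

mainTheorem18 : Weakening × Preservation × CwF × UniqueDerivations × SpheresClassify × Decidability
mainTheorem18 =
  (⊢T-weaken , ⊢t-weaken , ⊢s-weaken) ,
  (⊢C-inv , ⊢T-ctx , ⊢t-type , (λ s → ⊢s-dom s , ⊢s-cod s) , ⊢T-[] , ⊢t-[]) ,
  (⊢s-id , (λ {Γ} {A} _ → [id]T Γ A) , (λ {Γ} {t} _ → [id]t Γ t) , ⊢s-∘ , ∘-assoc ,
   (λ {Δ} {Γ} {γ} s → ∘-identityˡ s , ∘-identityʳ Δ γ) , ⊢T-[][] , ⊢t-[][]) ,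
  ((λ _ → ⊢C-irrelevant) , (λ _ _ → ⊢T-irrelevant) , (λ _ _ _ → ⊢t-irrelevant) , (λ _ _ _ → ⊢s-irrelevant)) ,
  spheres-classify ,
  (⊢C? , ⊢T? , ⊢t? , ⊢s?)
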